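{- Let $G$ be a graph. Suppose there are $i \in \mathbb{N}$ and sets $C_1, C_2, C'$ with $\pi^i \setminus \pi^{i-1} = \{C_1,C_2\}$ and $C' \in \pi^i \setminus \pi^{i+1}$. Then there are vertices $v'_1, v'_2 \in C'$ such that $|N(v'_1) \cap C_1| \neq |N(v'_2) \cap C_1|$.
   Context: All graphs are finite, simple, undirected, with monochromatic initial colouring. Colour Refinement computes $\chi^0_G$ constant and $\chi^i_G(v) = \big(\chi^{i-1}_G(v), \{\!\{\chi^{i-1}_G(w) \mid w \in N(v)\}\!\}\big)$, where $N(v)$ is the neighbourhood of $v$. $\pi^i = \pi^i_G$ is the partition of $V(G)$ into colour classes of $\chi^i_G$ (a set of subsets of $V(G)$). -}

module Defs where

open import Data.Nat using (ℕ; zero; suc; _∸_; _≡ᵇ_)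
open import Data.Bool using (Bool; true; false; _∧_)
open import Data.Fin using (Fin)
open import Data.Fin.Subset using (Subset; _∈_; _∩_; ∣_∣)
open import Data.Vec using (tabulate)
open import Data.List using (List; foldr; map; allFin)
open import Data.Product using (∃; _×_)
open import Relation.Binary.PropositionalEquality using (_≡_)

record Graph : Set where
  field
    n     : ℕ
    adj   : Fin n → Fin n → Bool
    sym   : ∀ u v → adj u v ≡ adj v u
    irref : ∀ v → adj v v ≡ false

allB : {A : Set} → (A → Bool) → List A → Bool
allB p xs = foldr _∧_ true (map p xs)

module _ (G : Graph) where
  open Graph G

  N : Fin n → Subset n
  N v = tabulate (adj v)

  mutual
    -- sameCol i v w = true  iff  χ^i_G(v) = χ^i_G(w)
    sameCol : ℕ → Fin n → Fin n → Bool
    sameCol zero    v w = true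
    sameCol (suc i) v w =
      sameCol i v w ∧
      allB (λ u → ∣ N v ∩ cls i u ∣ ≡ᵇ ∣ N w ∩ cls i u ∣) (allFin n)

    cls : ℕ → Fin n → Subset n
    cls i v = tabulate (sameCol i v)

  InPartition : ℕ → Subset n → Set
  InPartition i C = ∃ λ v → C ≡ cls i v

module Submission where

-- For i = 0 there are no new classes, so the hypothesis is contradictory.
-- For i = j+1, C' = cls c splits, so some v ∈ C' has the same i-colour as c
-- but a different (i+1)-colour; hence c and v have different numbers of
-- neighbours in some class X ∈ π^i.  Since c and v already agree on every
-- class of π^j, X is new, i.e. X = C₁ or X = C₂.  If X = C₁ we are done.  If
-- X = C₂, then the π^j-class containing C₂ is exactly the disjoint union
-- C₁ ∪ C₂; c and v agree on it, so they disagree on C₁.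

open import Defs
open import Data.Nat using (ℕ; zero; suc; _∸_; _+_)
open import Data.Nat.Properties using (≡ᵇ⇒≡; ≡⇒≡ᵇ; +-suc; +-cancelˡ-≡; _≟_)
open import Data.Bool using (T)
open import Data.Bool.Properties using (T-∧; T-≡)
open import Data.Fin using (Fin)
open import Data.Fin.Subset using (Subset; inside; outside; _∈_; _∉_; _⊆_; _∩_; _∪_; ∣_∣)
open import Data.Fin.Subset.Properties using (⊆-antisym; x∈p∩q⁻; x∈p∪q⁻; x∈p∪q⁺; ∩-distribˡ-∪)
open import Data.Fin.Properties using (any?; ¬∀⟶∃¬)
open import Data.Vec using ([]; _∷_; lookup; here; there)
open import Data.Vec.Properties using (lookup∘tabulate; []=⇒lookup; lookup⇒[]=)
open import Data.List using (allFin)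
open import Data.List.Relation.Unary.All as All using (All)
open import Data.List.Relation.Unary.All.Properties using (all⁺; all⁻)
open import Data.List.Membership.Propositional.Properties using (∈-allFin)
open import Data.Product using (∃; ∃₂; _×_; _,_; proj₁; proj₂)
open import Data.Sum using (_⊎_; inj₁; inj₂)
open import Data.Empty using (⊥-elim)
open import Function.Bundles using (_⇔_; mk⇔; Equivalence)
open import Relation.Nullary using (¬_; yes; no; Dec)
open import Relation.Nullary.Decidable using (T?; decidable-stable; _×-dec_; ¬?)
open import Relation.Binary.PropositionalEquality using (_≡_; _≢_; refl; sym; trans; cong; subst; module ≡-Reasoning)

Disjoint : ∀ {n} → Subset n → Subset n → Set
Disjoint p q = ∀ {x} → x ∈ p → x ∉ q

Disjoint-tail : ∀ {n s t} {p q : Subset n} → Disjoint (s ∷ p) (t ∷ q) → Disjoint p q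
Disjoint-tail disj x∈p x∈q = disj (there x∈p) (there x∈q)

∣∪∣-disjoint : ∀ {n} (p q : Subset n) → Disjoint p q → ∣ p ∪ q ∣ ≡ ∣ p ∣ + ∣ q ∣
∣∪∣-disjoint [] [] _ = refl
∣∪∣-disjoint (inside ∷ p) (inside ∷ q) disj = ⊥-elim (disj here here)
∣∪∣-disjoint (inside ∷ p) (outside ∷ q) disj =
  cong suc (∣∪∣-disjoint p q (Disjoint-tail disj))
∣∪∣-disjoint (outside ∷ p) (inside ∷ q) disj =
  trans (cong suc (∣∪∣-disjoint p q (Disjoint-tail disj)))
        (sym (+-suc ∣ p ∣ ∣ q ∣))
∣∪∣-disjoint (outside ∷ p) (outside ∷ q) disj =
  ∣∪∣-disjoint p q (Disjoint-tail disj)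

∣∩∪∣-disjoint : ∀ {n} (r p q : Subset n) → Disjoint p q →
                ∣ r ∩ (p ∪ q) ∣ ≡ ∣ r ∩ p ∣ + ∣ r ∩ q ∣
∣∩∪∣-disjoint r p q disj =
  trans (cong ∣_∣ (∩-distribˡ-∪ r p q))
        (∣∪∣-disjoint (r ∩ p) (r ∩ q) λ x∈r∩p x∈r∩q →
          disj (proj₂ (x∈p∩q⁻ r p x∈r∩p)) (proj₂ (x∈p∩q⁻ r q x∈r∩q)))

equal-on-∪-and-left⇒equal-on-right :
  ∀ {n} (r s p q : Subset n) → Disjoint p q →
  ∣ r ∩ (p ∪ q) ∣ ≡ ∣ s ∩ (p ∪ q) ∣ → ∣ r ∩ p ∣ ≡ ∣ s ∩ p ∣ → ∣ r ∩ q ∣ ≡ ∣ s ∩ q ∣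
equal-on-∪-and-left⇒equal-on-right r s p q disj on-∪ on-p = +-cancelˡ-≡ ∣ s ∩ p ∣ _ _ (begin
  ∣ s ∩ p ∣ + ∣ r ∩ q ∣  ≡⟨ cong (_+ ∣ r ∩ q ∣) (sym on-p) ⟩
  ∣ r ∩ p ∣ + ∣ r ∩ q ∣  ≡⟨ sym (∣∩∪∣-disjoint r p q disj) ⟩
  ∣ r ∩ (p ∪ q) ∣        ≡⟨ on-∪ ⟩
  ∣ s ∩ (p ∪ q) ∣        ≡⟨ ∣∩∪∣-disjoint s p q disj ⟩
  ∣ s ∩ p ∣ + ∣ s ∩ q ∣  ∎)
  where open ≡-Reasoning

∈⇔T-lookup : ∀ {n} {p : Subset n} {x : Fin n} → x ∈ p ⇔ T (lookup p x)
∈⇔T-lookup {p = p} {x} = mk⇔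
  (λ x∈p → Equivalence.from T-≡ ([]=⇒lookup x∈p))
  (λ t → lookup⇒[]= x p (Equivalence.to T-≡ t))

module ColourRefinement (G : Graph) where
  open Graph G using (n)

  Same : ℕ → Fin n → Fin n → Set
  Same i v w = T (sameCol G i v w)

  Same? : ∀ i v w → Dec (Same i v w)
  Same? i v w = T? (sameCol G i v w)

  deg : Fin n → Subset n → ℕ
  deg v X = ∣ N G v ∩ X ∣

  Same-suc⇔ : ∀ i {v w} → Same (suc i) v w ⇔
              (Same i v w × ∀ u → deg v (cls G i u) ≡ deg w (cls G i u))
  Same-suc⇔ i {v} {w} = mk⇔
    (λ s → let same , counts = Equivalence.to T-∧ s in
      same , λ u → ≡ᵇ⇒≡ _ _ (All.lookup (all⁺ _ (allFin n) counts) (∈-allFin u)))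
    (λ (same , counts) → Equivalence.from T-∧
      (same , all⁻ _ {allFin n} (All.tabulate λ {u} _ → ≡⇒≡ᵇ _ _ (counts u))))

  Same-refl : ∀ i v → Same i v v
  Same-refl zero    v = _
  Same-refl (suc i) v = Equivalence.from (Same-suc⇔ i) (Same-refl i v , λ _ → refl)

  Same-sym : ∀ i {v w} → Same i v w → Same i w v
  Same-sym zero    _ = _
  Same-sym (suc i) s =
    let same , counts = Equivalence.to (Same-suc⇔ i) s in
    Equivalence.from (Same-suc⇔ i) (Same-sym i same , λ u → sym (counts u))

  Same-trans : ∀ i {u v w} → Same i u v → Same i v w → Same i u w
  Same-trans zero    _ _ = _
  Same-trans (suc i) s t =
    let same₁ , counts₁ = Equivalence.to (Same-suc⇔ i) s
        same₂ , counts₂ = Equivalence.to (Same-suc⇔ i) t in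
    Equivalence.from (Same-suc⇔ i)
      (Same-trans i same₁ same₂ , λ x → trans (counts₁ x) (counts₂ x))

  Same-pred : ∀ i {v w} → Same (suc i) v w → Same i v w
  Same-pred i s = proj₁ (Equivalence.to (Same-suc⇔ i) s)

  ∈cls⇒Same : ∀ i {v x} → x ∈ cls G i v → Same i v x
  ∈cls⇒Same i {v} {x} m =
    subst T (lookup∘tabulate (sameCol G i v) x) (Equivalence.to ∈⇔T-lookup m)

  Same⇒∈cls : ∀ i {v x} → Same i v x → x ∈ cls G i v
  Same⇒∈cls i {v} {x} s =
    Equivalence.from ∈⇔T-lookup (subst T (sym (lookup∘tabulate (sameCol G i v) x)) s)

  ∈-own-cls : ∀ i v → v ∈ cls G i v
  ∈-own-cls i v = Same⇒∈cls i (Same-refl i v)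

  cls-cong : ∀ i {v w} → Same i v w → cls G i v ≡ cls G i w
  cls-cong i s = ⊆-antisym
    (λ m → Same⇒∈cls i (Same-trans i (Same-sym i s) (∈cls⇒Same i m)))
    (λ m → Same⇒∈cls i (Same-trans i s (∈cls⇒Same i m)))

  cls-injective : ∀ i {v w} → cls G i v ≡ cls G i w → Same i v w
  cls-injective i {w = w} e = ∈cls⇒Same i (subst (w ∈_) (sym e) (∈-own-cls i w))

  cls-refines : ∀ i v → cls G (suc i) v ⊆ cls G i v
  cls-refines i v m = Same⇒∈cls i (Same-pred i (∈cls⇒Same (suc i) m))

  old-class : ∀ i v → InPartition G i (cls G (suc i) v) → cls G (suc i) v ≡ cls G i v
  old-class i v (y , e) = trans e (cls-cong i y~v)
    where
    y~v : Same i y v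
    y~v = ∈cls⇒Same i (subst (v ∈_) e (∈-own-cls (suc i) v))

  split-witness : ∀ i v → cls G (suc i) v ≢ cls G i v →
                  ∃ λ w → Same i v w × ¬ Same (suc i) v w
  split-witness i v changed with any? (λ w → Same? i v w ×-dec ¬? (Same? (suc i) v w))
  ... | yes witness = witness
  ... | no none = ⊥-elim (changed (⊆-antisym (cls-refines i v) stays))
    where
    stays : cls G i v ⊆ cls G (suc i) v
    stays m = Same⇒∈cls (suc i) (decidable-stable (Same? (suc i) v _)
                λ separated → none (_ , ∈cls⇒Same i m , separated))

  separated⇒new : ∀ i {v w} → Same i v w → ¬ Same (suc i) v w →
                  ¬ InPartition G i (cls G (suc i) w)
  separated⇒new i {v} {w} v~w v≁w old = v≁w (Same-sym (suc i) (∈cls⇒Same (suc i) v∈))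
    where
    v∈ : v ∈ cls G (suc i) w
    v∈ = subst (v ∈_) (sym (old-class i w old)) (Same⇒∈cls i (Same-sym i v~w))

  distinguishing-class : ∀ i {v w} → Same i v w → ¬ Same (suc i) v w →
                         ∃ λ u → deg v (cls G i u) ≢ deg w (cls G i u)
  distinguishing-class i {v} {w} v~w v≁w =
    ¬∀⟶∃¬ n _ (λ u → deg v (cls G i u) ≟ deg w (cls G i u))
      (λ agree → v≁w (Equivalence.from (Same-suc⇔ i) (v~w , agree)))

  equal-deg-on-older-class : ∀ j {v w X} → Same (suc j) v w → InPartition G j X →
                             deg v X ≡ deg w X
  equal-deg-on-older-class j s (y , refl) = proj₂ (Equivalence.to (Same-suc⇔ j) s) y

  NewClasses : ℕ → Subset n → Subset n → Set
  NewClasses i C₁ C₂ =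
    ∀ C → (InPartition G i C × ¬ InPartition G (i ∸ 1) C) ⇔ (C ≡ C₁ ⊎ C ≡ C₂)

  -- If C₁, C₂ are the only new classes of round j+1, the class of π^j
  -- containing C₂ is the disjoint union C₁ ∪ C₂: it must split, and every
  -- piece other than C₂ is new, hence equal to C₁.
  parent-of-new-class : ∀ j {C₁ C₂ u} → NewClasses (suc j) C₁ C₂ →
                        cls G (suc j) u ≡ C₂ → cls G j u ≡ C₁ ∪ C₂ × Disjoint C₁ C₂
  parent-of-new-class j {C₁} {C₂} {u} new e₂
    with split-witness j u (λ e → proj₂ (Equivalence.from (new C₂) (inj₂ refl))
                                        (u , trans (sym e₂) e))
  ... | w , u~w , u≁w = ⊆-antisym parent⊆ ⊆parent , disjoint
    where
    new-piece : ∀ {k} → Same j u k → ¬ Same (suc j) u k →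
                cls G (suc j) k ≡ C₁ ⊎ cls G (suc j) k ≡ C₂
    new-piece {k} u~k u≁k = Equivalence.to (new _) ((k , refl) , separated⇒new j u~k u≁k)

    e₁ : cls G (suc j) w ≡ C₁
    e₁ with new-piece u~w u≁w
    ... | inj₁ e = e
    ... | inj₂ e = ⊥-elim (u≁w (cls-injective (suc j) (trans e₂ (sym e))))

    disjoint : Disjoint C₁ C₂
    disjoint x∈C₁ x∈C₂ = u≁w (Same-trans (suc j)
      (∈cls⇒Same (suc j) (subst (_ ∈_) (sym e₂) x∈C₂))
      (Same-sym (suc j) (∈cls⇒Same (suc j) (subst (_ ∈_) (sym e₁) x∈C₁))))

    parent⊆ : cls G j u ⊆ C₁ ∪ C₂
    parent⊆ {k} m with Same? (suc j) u k
    ... | yes u~k = x∈p∪q⁺ (inj₂ (subst (k ∈_) e₂ (Same⇒∈cls (suc j) u~k)))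
    ... | no u≁k with new-piece (∈cls⇒Same j m) u≁k
    ...   | inj₁ e = x∈p∪q⁺ (inj₁ (subst (k ∈_) e (∈-own-cls (suc j) k)))
    ...   | inj₂ e = x∈p∪q⁺ (inj₂ (subst (k ∈_) e (∈-own-cls (suc j) k)))

    ⊆parent : C₁ ∪ C₂ ⊆ cls G j u
    ⊆parent m with x∈p∪q⁻ C₁ C₂ m
    ... | inj₁ x∈C₁ = subst (_ ∈_) (cls-cong j (Same-sym j u~w))
                        (cls-refines j w (subst (_ ∈_) (sym e₁) x∈C₁))
    ... | inj₂ x∈C₂ = cls-refines j u (subst (_ ∈_) (sym e₂) x∈C₂)

lemma11 : (G : Graph) (i : ℕ) (C₁ C₂ C' : Subset (Graph.n G)) →
          (∀ C → (InPartition G i C × ¬ InPartition G (i ∸ 1) C) ⇔ (C ≡ C₁ ⊎ C ≡ C₂)) →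
          InPartition G i C' → ¬ InPartition G (suc i) C' →
          ∃₂ λ v₁ v₂ → v₁ ∈ C' × v₂ ∈ C' × ∣ N G v₁ ∩ C₁ ∣ ≢ ∣ N G v₂ ∩ C₁ ∣
-- Round 0 creates no new class, contradicting C₁ ∈ π^0 ∖ π^0.
lemma11 G zero C₁ C₂ C' new _ _ =
  let C₁∈π⁰ , C₁∉π⁰ = Equivalence.from (new C₁) (inj₁ refl) in ⊥-elim (C₁∉π⁰ C₁∈π⁰)
lemma11 G (suc j) C₁ C₂ C' new (c , refl) C'-splits =
  c , v , ∈-own-cls (suc j) c , Same⇒∈cls (suc j) c~v , differ-on-C₁ X-is-C₁-or-C₂
  where
  open ColourRefinement G

  -- C' = cls c splits, so some v ∈ C' is separated from c in round j+2 ...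
  separated : ∃ λ v → Same (suc j) c v × ¬ Same (suc (suc j)) c v
  separated = split-witness (suc j) c (λ e → C'-splits (c , sym e))
  v : Fin (Graph.n G)
  v = proj₁ separated
  c~v : Same (suc j) c v
  c~v = proj₁ (proj₂ separated)

  -- ... by their degrees into some class X ∈ π^(j+1),
  distinguishing : ∃ λ u → deg c (cls G (suc j) u) ≢ deg v (cls G (suc j) u)
  distinguishing = distinguishing-class (suc j) c~v (proj₂ (proj₂ separated))
  u : Fin (Graph.n G)
  u = proj₁ distinguishing
  X : Subset (Graph.n G)
  X = cls G (suc j) u
  differ-on-X : deg c X ≢ deg v X
  differ-on-X = proj₂ distinguishing

  -- ... which is not in π^j, because c and v agree on all classes of π^j.
  X-is-C₁-or-C₂ : X ≡ C₁ ⊎ X ≡ C₂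
  X-is-C₁-or-C₂ = Equivalence.to (new X)
    ((u , refl) , λ X∈πʲ → differ-on-X (equal-deg-on-older-class j c~v X∈πʲ))

  -- If X = C₂, equal degrees into C₁ and into the parent class C₁ ∪ C₂
  -- would force equal degrees into X.
  differ-on-C₁ : X ≡ C₁ ⊎ X ≡ C₂ → deg c C₁ ≢ deg v C₁
  differ-on-C₁ (inj₁ refl) = differ-on-X
  differ-on-C₁ (inj₂ X≡C₂) agree-on-C₁ =
    let parent≡C₁∪C₂ , disjoint = parent-of-new-class j new X≡C₂ in
    differ-on-X (subst (λ Y → deg c Y ≡ deg v Y) (sym X≡C₂)
      (equal-on-∪-and-left⇒equal-on-right (N G c) (N G v) C₁ C₂ disjoint
        (subst (λ Y → deg c Y ≡ deg v Y) parent≡C₁∪C₂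
          (equal-deg-on-older-class j c~v (u , refl)))
        agree-on-C₁))
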